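{- It is decidable whether a given finite forest category (finitely many objects, arrows and half-arrows, with all operations given explicitly) is globally idempotent and commutative.
   Context: Forest algebras. A forest algebra $(H,V)$ consists of a commutative monoid $H$ (additive, identity $0$), a monoid $V$, and a faithful right action $H\times V\to H$ such that for $v\in V$, $h\in H$ there is $v+h\in V$ with $g(v+h)=gv+h$ for all $g\in H$. If $H$ is an idempotent commutative monoid, $H$ acting on itself by $hv=h+v$ gives a forest algebra $(H,H)$, called a flat idempotent and commutative forest algebra. Forest categories. A forest category $\mathcal C$ consists of: a finite set $\mathrm{Obj}(\mathcal C)$ which is a commutative monoid under $+$ with identity $0$; for all objects $x,y$ a set $\mathrm{Arr}(x,y)$ of arrows (pairwise disjoint); for each object $x$ a set $\mathrm{HArr}(x)$ of half-arrows to $x$ (pairwise disjoint), subject to: (1) the set of all half-arrows is a commutative monoid under $+$ with $\mathrm{HArr}(x)+\mathrm{HArr}(y)\subseteq\mathrm{HArr}(x+y)$, the end map being a homomorphism onto $\mathrm{Obj}(\mathcal C)$; (2) an associative composition $\mathrm{Arr}(x,y)\times\mathrm{Arr}(y,z)\to\mathrm{Arr}(x,z)$ with identity arrows $1_x$; (3) an action $\mathrm{HArr}(x)\times\mathrm{Arr}(x,y)\to\mathrm{HArr}(y)$, $(c,u)\mapsto cu$, with $(cu)v=c(uv)$, $c1_x=c$, faithful (if $cu=cu'$ for all $c\in\mathrm{HArr}(x)$ then $u=u'$); (4) for $u\in\mathrm{Arr}(x,y)$, $c\in\mathrm{HArr}(z)$ an arrow $u+c\in\mathrm{Arr}(x,y+z)$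 with $f(u+c)=(fu)+c$ for all $f\in\mathrm{Arr}(w,x)$ and $(u+c)+d=u+(c+d)$. Division. $\mathcal C\prec(H,V)$ means: there are nonempty sets $K_c\subseteq H$ for each half-arrow $c$ and $K_u\subseteq V$ for each arrow $u$ with $K_uK_v\subseteq K_{uv}$, $K_cK_u\subseteq K_{cu}$, $K_c+K_d\subseteq K_{c+d}$, $K_u+K_c\subseteq K_{u+c}$ whenever defined, and distinct arrows in the same $\mathrm{Arr}(x,y)$ (resp. distinct half-arrows in the same $\mathrm{HArr}(y)$) have disjoint covering sets. $\mathcal C$ is globally idempotent and commutative if it divides some flat idempotent and commutative forest algebra. -}

module Defs where

open import Data.Nat using (ℕ)
open import Data.Fin using (Fin)
open import Data.Product using (Σ; ∃; _×_; Σ-syntax)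
open import Relation.Binary.PropositionalEquality using (_≡_)
open import Relation.Nullary using (¬_)
open import Data.Empty using (⊥)
open import Algebra.Structures using (IsCommutativeMonoid; IsIdempotentCommutativeMonoid)

-- Arr(x,y) = { u | src u ≡ x , tgt u ≡ y },  HArr(x) = { c | end c ≡ x }
-- (so these sets are automatically pairwise disjoint).
-- Composition `u ∙ v` (u then v, i.e. uv ∈ Arr(x,z) for u ∈ Arr(x,y), v ∈ Arr(y,z))
-- and the action `act c u` (= cu) are given as total functions; only their
-- values on composable pairs are meaningful, and all axioms are imposed
-- exactly on composable pairs.
record ForestCategory : Set where
  field
    nObj nArr nHArr : ℕ
    _⊕_ : Fin nObj → Fin nObj → Fin nObj
    o0  : Fin nObj
    obj-isCM : IsCommutativeMonoid _≡_ _⊕_ o0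
    src tgt : Fin nArr → Fin nObj
    end : Fin nHArr → Fin nObj
    _⊞_ : Fin nHArr → Fin nHArr → Fin nHArr
    h0  : Fin nHArr
    harr-isCM : IsCommutativeMonoid _≡_ _⊞_ h0
    end-+ : ∀ c d → end (c ⊞ d) ≡ end c ⊕ end d
    end-0 : end h0 ≡ o0
    end-onto : ∀ x → ∃ λ c → end c ≡ x
    _∙_ : Fin nArr → Fin nArr → Fin nArr
    ∙-src : ∀ u v → tgt u ≡ src v → src (u ∙ v) ≡ src u
    ∙-tgt : ∀ u v → tgt u ≡ src v → tgt (u ∙ v) ≡ tgt v
    ∙-assoc : ∀ u v w → tgt u ≡ src v → tgt v ≡ src w → (u ∙ v) ∙ w ≡ u ∙ (v ∙ w)
    idArr : Fin nObj → Fin nArr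
    idArr-src : ∀ x → src (idArr x) ≡ x
    idArr-tgt : ∀ x → tgt (idArr x) ≡ x
    idArr-left  : ∀ x u → src u ≡ x → idArr x ∙ u ≡ u
    idArr-right : ∀ y u → tgt u ≡ y → u ∙ idArr y ≡ u
    act : Fin nHArr → Fin nArr → Fin nHArr
    act-end : ∀ c u → end c ≡ src u → end (act c u) ≡ tgt u
    act-assoc : ∀ c u v → end c ≡ src u → tgt u ≡ src v →
                act (act c u) v ≡ act c (u ∙ v)
    act-id : ∀ x c → end c ≡ x → act c (idArr x) ≡ c
    act-faithful : ∀ u u' → src u ≡ src u' → tgt u ≡ tgt u' →
                   (∀ c → end c ≡ src u → act c u ≡ act c u') → u ≡ u'
    plus : Fin nArr → Fin nHArr → Fin nArr
    plus-src : ∀ u c → src (plus u c) ≡ src u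
    plus-tgt : ∀ u c → tgt (plus u c) ≡ tgt u ⊕ end c
    plus-∙ : ∀ f u c → tgt f ≡ src u → f ∙ plus u c ≡ plus (f ∙ u) c
    plus-assoc : ∀ u c d → plus (plus u c) d ≡ plus u (c ⊞ d)

-- A flat idempotent and commutative forest algebra (H,H):
-- H an idempotent commutative monoid acting on itself by h v = h + v.
-- Its vertical monoid V = H with multiplication +, action h v = h + v,
-- and v + h computed in H.
record FlatICForestAlgebra : Set₁ where
  field
    H : Set
    _+_ : H → H → H
    zero : H
    isICM : IsIdempotentCommutativeMonoid _≡_ _+_ zero

record Divides (C : ForestCategory) (F : FlatICForestAlgebra) : Set₁ where
  open ForestCategory C
  open FlatICForestAlgebra F
  field
    KArr  : Fin nArr  → H → Set
    KHArr : Fin nHArr → H → Set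
    KArr-nonempty  : ∀ u → ∃ λ h → KArr u h
    KHArr-nonempty : ∀ c → ∃ λ h → KHArr c h
    K-∙ : ∀ u v → tgt u ≡ src v → ∀ g h → KArr u g → KArr v h → KArr (u ∙ v) (g + h)
    K-act : ∀ c u → end c ≡ src u → ∀ g h → KHArr c g → KArr u h → KHArr (act c u) (g + h)
    K-⊞ : ∀ c d g h → KHArr c g → KHArr d h → KHArr (c ⊞ d) (g + h)
    K-plus : ∀ u c g h → KArr u g → KHArr c h → KArr (plus u c) (g + h)
    KArr-disjoint : ∀ u u' → src u ≡ src u' → tgt u ≡ tgt u' → ¬ (u ≡ u') →
                    ∀ h → KArr u h → KArr u' h → ⊥
    KHArr-disjoint : ∀ c c' → end c ≡ end c' → ¬ (c ≡ c') →
                     ∀ h → KHArr c h → KHArr c' h → ⊥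

GloballyIdemComm : ForestCategory → Set₁
GloballyIdemComm C = Σ[ F ∈ FlatICForestAlgebra ] Divides C F

-- A division of C into a flat idempotent and commutative forest algebra
-- (H , H) can be pulled back along the homomorphism from the free one,
-- the subsets of the nArr + nHArr arrows and half-arrows under union,
-- that sends each generator to a chosen element of its covering set.  So
-- C is globally idempotent and commutative iff it divides this single
-- finite algebra, and the finitely many candidate coverings of it can be
-- searched exhaustively.  Covering sets are arbitrary predicates,
-- hence only ¬¬-decidable; that suffices, since an unsuccessful search
-- only has to refute the existence of a division.
module Submission where

open import Defs
open import Algebra.Bundles using (IdempotentCommutativeMonoid)
open import Level using (0ℓ)
open import Data.Fin using (Fin; zero; suc; splitAt; join; _≟_)
open import Data.Fin.Properties using (all?; splitAt-join)
open import Data.Fin.Subset using (Subset; _∈_; _∪_; ⁅_⁆; inside; outside) renaming (⊥ to ∅)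
open import Data.Fin.Subset.Properties using (_∈?_; anySubset?; drop-there; ∪-isIdempotentCommutativeMonoid)
open import Data.Nat using (ℕ; zero; suc)
import Data.Nat as ℕ
open import Data.Empty using (⊥)
open import Data.Product using (∃; _×_; _,_; proj₁; proj₂)
open import Data.Sum using (inj₁; inj₂; [_,_]′)
open import Data.Vec using ([]; _∷_; here; there)
open import Effect.Monad using (RawMonad)
open import Function using (_∘_)
open import Function.Bundles using (_⇔_; mk⇔; Equivalence)
open import Relation.Binary.PropositionalEquality using (_≡_; refl; sym; trans; cong; subst)
open import Relation.Nullary using (Dec; yes; no; ¬_; contradiction)
open import Relation.Nullary.Decidable using (_×-dec_; _→-dec_; ¬?; map′; decidable-stable; ¬¬-excluded-middle)
open import Relation.Nullary.Negation using (DoubleNegation; ¬¬-Monad)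
open import Relation.Unary using (Decidable)

open RawMonad (¬¬-Monad {0ℓ}) using (pure; _>>=_)
open Equivalence using (to; from)

private
  variable
    A B X : Set
    m n : ℕ

Searchable : Set → Set₁
Searchable A = {P : A → Set} → Decidable P → Dec (∃ P)

×-searchable : Searchable A → Searchable B → Searchable (A × B)
×-searchable searchA searchB P? =
  map′ (λ (a , b , p) → (a , b) , p) (λ ((a , b) , p) → a , b , p)
       (searchA λ a → searchB λ b → P? (a , b))

allSubset? : {P : Subset n → Set} → Decidable P → Dec (∀ S → P S)
allSubset? P? with anySubset? (¬? ∘ P?)
... | yes (S , ¬PS) = no λ ∀P → ¬PS (∀P S)
... | no ∄¬P = yes λ S → decidable-stable (P? S) λ ¬PS → ∄¬P (S , ¬PS)

-- A function Subset m → X written out as a finite product, so that it can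
-- be searched without function extensionality.
Table : ℕ → Set → Set
Table zero    X = X
Table (suc m) X = Table m X × Table m X

lookupTable : Table m X → Subset m → X
lookupTable {zero}  x        []            = x
lookupTable {suc m} (t₀ , _) (outside ∷ S) = lookupTable t₀ S
lookupTable {suc m} (_ , t₁) (inside ∷ S)  = lookupTable t₁ S

table-searchable : Searchable X → ∀ m → Searchable (Table m X)
table-searchable searchX zero    = searchX
table-searchable searchX (suc m) =
  ×-searchable (table-searchable searchX m) (table-searchable searchX m)

¬¬-tabulate : ∀ m {Q : Subset m → X → Set} → (∀ S → DoubleNegation (∃ (Q S))) →
              DoubleNegation (∃ λ (t : Table m X) → ∀ S → Q S (lookupTable t S))
¬¬-tabulate zero    q = do
  (x , qx) ← q []
  pure (x , λ { [] → qx })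
¬¬-tabulate (suc m) q = do
  (t₀ , q₀) ← ¬¬-tabulate m (q ∘ (outside ∷_))
  (t₁ , q₁) ← ¬¬-tabulate m (q ∘ (inside ∷_))
  pure ((t₀ , t₁) , λ { (outside ∷ S) → q₀ S ; (inside ∷ S) → q₁ S })

¬¬-characteristicSubset : ∀ n (P : Fin n → Set) →
                          DoubleNegation (∃ λ (S : Subset n) → ∀ i → P i ⇔ i ∈ S)
¬¬-characteristicSubset zero    P = pure ([] , λ ())
¬¬-characteristicSubset (suc n) P = do
  (S , P⇔∈S) ← ¬¬-characteristicSubset n (P ∘ suc)
  P₀? ← ¬¬-excluded-middle
  pure (extend S P⇔∈S P₀?)
  where
  P⇔∈tail : ∀ {b} (S : Subset n) → (∀ i → P (suc i) ⇔ i ∈ S) → ∀ i → P (suc i) ⇔ suc i ∈ b ∷ S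
  P⇔∈tail S P⇔∈S i = mk⇔ (there ∘ to (P⇔∈S i)) (from (P⇔∈S i) ∘ drop-there)

  extend : (S : Subset n) → (∀ i → P (suc i) ⇔ i ∈ S) → Dec (P zero) →
           ∃ λ (S′ : Subset (suc n)) → ∀ i → P i ⇔ i ∈ S′
  extend S P⇔∈S (yes P₀) = inside ∷ S , λ
    { zero    → mk⇔ (λ _ → here) (λ _ → P₀)
    ; (suc i) → P⇔∈tail S P⇔∈S i }
  extend S P⇔∈S (no ¬P₀) = outside ∷ S , λ
    { zero    → mk⇔ (λ P₀ → contradiction P₀ ¬P₀) (λ ())
    ; (suc i) → P⇔∈tail S P⇔∈S i }

FreeFlat : ℕ → FlatICForestAlgebra
FreeFlat m = record
  { H = Subset m ; _+_ = _∪_ ; zero = ∅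
  ; isICM = ∪-isIdempotentCommutativeMonoid m }

module Evaluation (F : FlatICForestAlgebra) where
  open FlatICForestAlgebra F renaming (zero to 0H)

  private
    icm : IdempotentCommutativeMonoid _ _
    icm = record { isIdempotentCommutativeMonoid = isICM }
  open IdempotentCommutativeMonoid icm using (assoc; identityʳ)
  open import Algebra.Properties.IdempotentCommutativeMonoid icm using (∙-distrˡ-∙)
  open import Algebra.Properties.CommutativeSemigroup
    (IdempotentCommutativeMonoid.commutativeSemigroup icm) using (x∙yz≈y∙xz)

  evaluate : (Fin m → H) → Subset m → H
  evaluate k []            = 0H
  evaluate k (inside ∷ S)  = k zero + evaluate (k ∘ suc) S
  evaluate k (outside ∷ S) = evaluate (k ∘ suc) S

  evaluate-∅ : (k : Fin m → H) → evaluate k ∅ ≡ 0H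
  evaluate-∅ {zero}  k = refl
  evaluate-∅ {suc m} k = evaluate-∅ (k ∘ suc)

  evaluate-⁅⁆ : (k : Fin m → H) (i : Fin m) → evaluate k ⁅ i ⁆ ≡ k i
  evaluate-⁅⁆ k zero    = trans (cong (k zero +_) (evaluate-∅ (k ∘ suc))) (identityʳ (k zero))
  evaluate-⁅⁆ k (suc i) = evaluate-⁅⁆ (k ∘ suc) i

  evaluate-∪ : (k : Fin m → H) (S T : Subset m) → evaluate k (S ∪ T) ≡ evaluate k S + evaluate k T
  evaluate-∪ k []            []            = sym (identityʳ 0H)
  evaluate-∪ k (inside ∷ S)  (inside ∷ T)  =
    trans (cong (k zero +_) (evaluate-∪ (k ∘ suc) S T)) (∙-distrˡ-∙ (k zero) _ _)
  evaluate-∪ k (inside ∷ S)  (outside ∷ T) =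
    trans (cong (k zero +_) (evaluate-∪ (k ∘ suc) S T)) (sym (assoc (k zero) _ _))
  evaluate-∪ k (outside ∷ S) (inside ∷ T)  =
    trans (cong (k zero +_) (evaluate-∪ (k ∘ suc) S T)) (x∙yz≈y∙xz (k zero) _ _)
  evaluate-∪ k (outside ∷ S) (outside ∷ T) = evaluate-∪ (k ∘ suc) S T

module _ (C : ForestCategory) (F : FlatICForestAlgebra) where
  open ForestCategory C
  open FlatICForestAlgebra F

  IsDivision : (Fin nArr → H → Set) → (Fin nHArr → H → Set) → Set
  IsDivision KArr KHArr =
      (∀ u → ∃ (KArr u))
    × (∀ c → ∃ (KHArr c))
    × (∀ u v → tgt u ≡ src v → ∀ g h → KArr u g → KArr v h → KArr (u ∙ v) (g + h))
    × (∀ c u → end c ≡ src u → ∀ g h → KHArr c g → KArr u h → KHArr (act c u) (g + h))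
    × (∀ c d g h → KHArr c g → KHArr d h → KHArr (c ⊞ d) (g + h))
    × (∀ u c g h → KArr u g → KHArr c h → KArr (plus u c) (g + h))
    × (∀ u u′ → src u ≡ src u′ → tgt u ≡ tgt u′ → ¬ u ≡ u′ →
       ∀ h → KArr u h → KArr u′ h → ⊥)
    × (∀ c c′ → end c ≡ end c′ → ¬ c ≡ c′ → ∀ h → KHArr c h → KHArr c′ h → ⊥)

  isDivision : (D : Divides C F) → IsDivision (Divides.KArr D) (Divides.KHArr D)
  isDivision D = KArr-nonempty , KHArr-nonempty , K-∙ , K-act , K-⊞ , K-plus
               , KArr-disjoint , KHArr-disjoint
    where open Divides D

  division : ∀ {KArr KHArr} → IsDivision KArr KHArr → Divides C F
  division {KArr} {KHArr} (a₁ , a₂ , a₃ , a₄ , a₅ , a₆ , a₇ , a₈) = record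
    { KArr = KArr ; KHArr = KHArr
    ; KArr-nonempty = a₁ ; KHArr-nonempty = a₂
    ; K-∙ = a₃ ; K-act = a₄ ; K-⊞ = a₅ ; K-plus = a₆
    ; KArr-disjoint = a₇ ; KHArr-disjoint = a₈ }

  IsDivision-resp-⇔ : ∀ {KArr KArr′ KHArr KHArr′} →
                      (∀ u h → KArr u h ⇔ KArr′ u h) → (∀ c h → KHArr c h ⇔ KHArr′ c h) →
                      IsDivision KArr KHArr → IsDivision KArr′ KHArr′
  IsDivision-resp-⇔ {KArr} {KArr′} {KHArr} {KHArr′} A⇔ H⇔ (a₁ , a₂ , a₃ , a₄ , a₅ , a₆ , a₇ , a₈) =
      (λ u → let (h , p) = a₁ u in h , toA p)
    , (λ c → let (h , p) = a₂ c in h , toH p)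
    , (λ u v e g h p q → toA (a₃ u v e g h (fromA p) (fromA q)))
    , (λ c u e g h p q → toH (a₄ c u e g h (fromH p) (fromA q)))
    , (λ c d g h p q → toH (a₅ c d g h (fromH p) (fromH q)))
    , (λ u c g h p q → toA (a₆ u c g h (fromA p) (fromH q)))
    , (λ u u′ e₁ e₂ ne h p q → a₇ u u′ e₁ e₂ ne h (fromA p) (fromA q))
    , (λ c c′ e ne h p q → a₈ c c′ e ne h (fromH p) (fromH q))
    where
    toA : ∀ {u h} → KArr u h → KArr′ u h
    toA = to (A⇔ _ _)
    fromA : ∀ {u h} → KArr′ u h → KArr u h
    fromA = from (A⇔ _ _)
    toH : ∀ {c h} → KHArr c h → KHArr′ c h
    toH = to (H⇔ _ _)
    fromH : ∀ {c h} → KHArr′ c h → KHArr c h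
    fromH = from (H⇔ _ _)

module _ (C : ForestCategory) where
  open ForestCategory C

  generators : ℕ
  generators = nArr ℕ.+ nHArr

  divides⇒dividesFreeFlat : (F : FlatICForestAlgebra) → Divides C F → Divides C (FreeFlat generators)
  divides⇒dividesFreeFlat F D = record
    { KArr = λ u S → KArr u (evaluate gen S)
    ; KHArr = λ c S → KHArr c (evaluate gen S)
    ; KArr-nonempty = λ u → ⁅ join nArr nHArr (inj₁ u) ⁆ ,
        subst (KArr u) (sym (evaluate-⁅join⁆ (inj₁ u))) (proj₂ (KArr-nonempty u))
    ; KHArr-nonempty = λ c → ⁅ join nArr nHArr (inj₂ c) ⁆ ,
        subst (KHArr c) (sym (evaluate-⁅join⁆ (inj₂ c))) (proj₂ (KHArr-nonempty c))
    ; K-∙ = λ u v e g h p q → ∪-closed KArr g h (K-∙ u v e _ _ p q)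
    ; K-act = λ c u e g h p q → ∪-closed KHArr g h (K-act c u e _ _ p q)
    ; K-⊞ = λ c d g h p q → ∪-closed KHArr g h (K-⊞ c d _ _ p q)
    ; K-plus = λ u c g h p q → ∪-closed KArr g h (K-plus u c _ _ p q)
    ; KArr-disjoint = λ u u′ e₁ e₂ ne S → KArr-disjoint u u′ e₁ e₂ ne (evaluate gen S)
    ; KHArr-disjoint = λ c c′ e ne S → KHArr-disjoint c c′ e ne (evaluate gen S) }
    where
    open FlatICForestAlgebra F
    open Divides D
    open Evaluation F

    gen : Fin generators → H
    gen = [ proj₁ ∘ KArr-nonempty , proj₁ ∘ KHArr-nonempty ]′ ∘ splitAt nArr

    evaluate-⁅join⁆ : ∀ x → evaluate gen ⁅ join nArr nHArr x ⁆ ≡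
                            [ proj₁ ∘ KArr-nonempty , proj₁ ∘ KHArr-nonempty ]′ x
    evaluate-⁅join⁆ x = trans (evaluate-⁅⁆ gen _)
      (cong [ proj₁ ∘ KArr-nonempty , proj₁ ∘ KHArr-nonempty ]′ (splitAt-join nArr nHArr x))

    ∪-closed : ∀ {I : Set} (K : I → H → Set) {i} g h →
               K i (evaluate gen g + evaluate gen h) → K i (evaluate gen (g ∪ h))
    ∪-closed K g h = subst (K _) (sym (evaluate-∪ gen g h))

  -- At each subset S, a covering lists the arrows and half-arrows whose
  -- covering set contains S.
  Covering : Set
  Covering = Table generators (Subset nArr × Subset nHArr)

  KArrᵗ : Covering → Fin nArr → Subset generators → Set
  KArrᵗ R u S = u ∈ proj₁ (lookupTable R S)

  KHArrᵗ : Covering → Fin nHArr → Subset generators → Set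
  KHArrᵗ R c S = c ∈ proj₂ (lookupTable R S)

  searchCovering : Searchable Covering
  searchCovering = table-searchable (×-searchable anySubset? anySubset?) generators

  isDivision? : (R : Covering) → Dec (IsDivision C (FreeFlat generators) (KArrᵗ R) (KHArrᵗ R))
  isDivision? R =
          all? (λ u → anySubset? λ _ → u ∈? _)
    ×-dec all? (λ c → anySubset? λ _ → c ∈? _)
    ×-dec all? (λ u → all? λ v → (tgt u ≟ src v) →-dec
            allSubset? λ g → allSubset? λ h → (u ∈? _) →-dec (v ∈? _) →-dec (_ ∈? _))
    ×-dec all? (λ c → all? λ u → (end c ≟ src u) →-dec
            allSubset? λ g → allSubset? λ h → (c ∈? _) →-dec (u ∈? _) →-dec (_ ∈? _))
    ×-dec all? (λ c → all? λ d →
            allSubset? λ g → allSubset? λ h → (c ∈? _) →-dec (d ∈? _) →-dec (_ ∈? _))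
    ×-dec all? (λ u → all? λ c →
            allSubset? λ g → allSubset? λ h → (u ∈? _) →-dec (c ∈? _) →-dec (_ ∈? _))
    ×-dec all? (λ u → all? λ u′ → (src u ≟ src u′) →-dec (tgt u ≟ tgt u′) →-dec ¬? (u ≟ u′) →-dec
            allSubset? λ h → (u ∈? _) →-dec (u′ ∈? _) →-dec no (λ ()))
    ×-dec all? (λ c → all? λ c′ → (end c ≟ end c′) →-dec ¬? (c ≟ c′) →-dec
            allSubset? λ h → (c ∈? _) →-dec (c′ ∈? _) →-dec no (λ ()))

  dividesFreeFlat⇒¬¬covering : Divides C (FreeFlat generators) →
    DoubleNegation (∃ λ R → IsDivision C (FreeFlat generators) (KArrᵗ R) (KHArrᵗ R))
  dividesFreeFlat⇒¬¬covering D = do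
    (R , characterises) ← ¬¬-tabulate generators λ S → do
      (A , A⇔) ← ¬¬-characteristicSubset nArr λ u → KArr u S
      (B , B⇔) ← ¬¬-characteristicSubset nHArr λ c → KHArr c S
      pure ((A , B) , A⇔ , B⇔)
    pure (R , IsDivision-resp-⇔ C (FreeFlat generators)
                (λ u S → proj₁ (characterises S) u) (λ c S → proj₂ (characterises S) c)
                (isDivision C (FreeFlat generators) D))
    where open Divides D

theorem4 : (C : ForestCategory) → Dec (GloballyIdemComm C)
theorem4 C with searchCovering C (isDivision? C)
... | yes (R , isDiv) = yes (FreeFlat (generators C) , division C (FreeFlat (generators C)) isDiv)
... | no ∄R = no λ (F , D) →
  dividesFreeFlat⇒¬¬covering C (divides⇒dividesFreeFlat C F D) ∄R
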